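{- The system $\mathsf{NL}^{+}+\{\mathrm{Id1}\}$, obtained by adding the axiom scheme (Id1) $\varphi\otimes\varphi\Rightarrow\varphi$ to $\mathsf{NL}^{+}$, is trivial: every formula is a theorem of it.
   Context: Formulas: built from countably many variables with binary $\otimes,\circ$ and unary ${}^{*}$. Abbreviations: $\varphi\Rightarrow\psi:=(\varphi\circ\psi^{*})^{*}$; $\varphi\Leftrightarrow\psi:=(\varphi\Rightarrow\psi)\otimes(\psi\Rightarrow\varphi)$; $\varphi\not\Leftrightarrow\psi:=(\varphi\Leftrightarrow\psi)^{*}$; $\varphi\not\Leftrightarrow\psi\not\Leftrightarrow\chi:=((\varphi\not\Leftrightarrow\psi)\otimes(\varphi\not\Leftrightarrow\chi))\otimes(\psi\not\Leftrightarrow\chi)$; $\varphi\oplus\psi:=(\varphi^{*}\otimes\psi^{*})^{*}$. The theorems of $\mathsf{NL}^{+}$ are generated from all instances of (A1) $\varphi\Rightarrow\varphi$; (A2) $(\varphi\circ\psi)\Rightarrow(\psi\circ\varphi)$; (A3) $\varphi\Rightarrow\varphi^{**}$; (A4) $(\varphi\Rightarrow\psi)\Rightarrow(\varphi\circ\psi)$; (A5) $(\varphi\otimes\psi)\Leftrightarrow(\psi\otimes\varphi)$; (A6) $((\varphi\otimes\psi)\Rightarrow\chi)\Rightarrow((\varphi\otimes\chi^{*})\Rightarrow\psi^{*})$; (A7) $(\varphi\not\Leftrightarrow\psi\not\Leftrightarrow\chi)\Rightarrow((\varphi\Rightarrow\psi)\Rightarrow((\psi\Rightarrow\chi)\Rightarrow(\varphi\Rightarrow\chi)))$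 by the rules, applied to theorems only: from $\vdash\varphi\Rightarrow\psi$ and $\vdash\varphi$ infer $\vdash\psi$; from $\vdash\varphi$ and $\vdash\psi$ infer $\vdash\varphi\otimes\psi$; from $\vdash\varphi\Leftrightarrow\psi$ and $\vdash\chi$ infer $\vdash\chi'$ ($\chi'$ obtained from $\chi$ by replacing one or more occurrences of $\varphi$ by $\psi$); from $\vdash\varphi\otimes\psi$ infer $\vdash\varphi$; from $\vdash\varphi$ infer $\vdash\varphi\oplus\psi$. -}

module Defs where

open import Data.Nat using (ℕ)

infixl 6 _⊗_ _∘_
infix 7 _*

data Formula : Set where
  var : ℕ → Formula
  _⊗_ : Formula → Formula → Formula
  _∘_ : Formula → Formula → Formula
  _* : Formula → Formula

infixr 4 _⇒_ _⇔_ _⇎_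

_⇒_ : Formula → Formula → Formula
φ ⇒ ψ = (φ ∘ (ψ *)) *

_⇔_ : Formula → Formula → Formula
φ ⇔ ψ = (φ ⇒ ψ) ⊗ (ψ ⇒ φ)

_⇎_ : Formula → Formula → Formula
φ ⇎ ψ = (φ ⇔ ψ) *

⇎3 : Formula → Formula → Formula → Formula
⇎3 φ ψ χ = ((φ ⇎ ψ) ⊗ (φ ⇎ χ)) ⊗ (ψ ⇎ χ)

_⊕_ : Formula → Formula → Formula
φ ⊕ ψ = ((φ *) ⊗ (ψ *)) *

-- Rep φ ψ χ χ'   : χ' arises from χ by replacing zero or more occurrences of φ by ψ.
-- Rep1 φ ψ χ χ'  : χ' arises from χ by replacing one or more occurrences of φ by ψ.
data Rep (φ ψ : Formula) : Formula → Formula → Set where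
  here  : Rep φ ψ φ ψ
  var   : ∀ n → Rep φ ψ (var n) (var n)
  _⊗_   : ∀ {a a' b b'} → Rep φ ψ a a' → Rep φ ψ b b' → Rep φ ψ (a ⊗ b) (a' ⊗ b')
  _∘_   : ∀ {a a' b b'} → Rep φ ψ a a' → Rep φ ψ b b' → Rep φ ψ (a ∘ b) (a' ∘ b')
  _*    : ∀ {a a'} → Rep φ ψ a a' → Rep φ ψ (a *) (a' *)

data Rep1 (φ ψ : Formula) : Formula → Formula → Set where
  here  : Rep1 φ ψ φ ψ
  ⊗ˡ    : ∀ {a a' b b'} → Rep1 φ ψ a a' → Rep φ ψ b b' → Rep1 φ ψ (a ⊗ b) (a' ⊗ b')
  ⊗ʳ    : ∀ {a a' b b'} → Rep φ ψ a a' → Rep1 φ ψ b b' → Rep1 φ ψ (a ⊗ b) (a' ⊗ b')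
  ∘ˡ    : ∀ {a a' b b'} → Rep1 φ ψ a a' → Rep φ ψ b b' → Rep1 φ ψ (a ∘ b) (a' ∘ b')
  ∘ʳ    : ∀ {a a' b b'} → Rep φ ψ a a' → Rep1 φ ψ b b' → Rep1 φ ψ (a ∘ b) (a' ∘ b')
  _*    : ∀ {a a'} → Rep1 φ ψ a a' → Rep1 φ ψ (a *) (a' *)

data ⊢Id1 : Formula → Set where
  A1  : ∀ φ → ⊢Id1 (φ ⇒ φ)
  A2  : ∀ φ ψ → ⊢Id1 ((φ ∘ ψ) ⇒ (ψ ∘ φ))
  A3  : ∀ φ → ⊢Id1 (φ ⇒ ((φ *) *))
  A4  : ∀ φ ψ → ⊢Id1 ((φ ⇒ ψ) ⇒ (φ ∘ ψ))
  A5  : ∀ φ ψ → ⊢Id1 ((φ ⊗ ψ) ⇔ (ψ ⊗ φ))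
  A6  : ∀ φ ψ χ → ⊢Id1 (((φ ⊗ ψ) ⇒ χ) ⇒ ((φ ⊗ (χ *)) ⇒ (ψ *)))
  A7  : ∀ φ ψ χ → ⊢Id1 (⇎3 φ ψ χ ⇒ ((φ ⇒ ψ) ⇒ ((ψ ⇒ χ) ⇒ (φ ⇒ χ))))
  Id1 : ∀ φ → ⊢Id1 ((φ ⊗ φ) ⇒ φ)
  MP  : ∀ {φ ψ} → ⊢Id1 (φ ⇒ ψ) → ⊢Id1 φ → ⊢Id1 ψ
  Adj : ∀ {φ ψ} → ⊢Id1 φ → ⊢Id1 ψ → ⊢Id1 (φ ⊗ ψ)
  Sub : ∀ {φ ψ χ χ'} → ⊢Id1 (φ ⇔ ψ) → ⊢Id1 χ → Rep1 φ ψ χ χ' → ⊢Id1 χ'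
  Simp : ∀ {φ ψ} → ⊢Id1 (φ ⊗ ψ) → ⊢Id1 φ
  Add : ∀ {φ} ψ → ⊢Id1 φ → ⊢Id1 (φ ⊕ ψ)

{-# OPTIONS --safe #-}
module Submission where

open import Defs

-- Contraposing Id1 with A6 gives (φ ⊗ φ*) ⇒ φ*, and commuting and contraposing
-- once more gives (φ* ⊗ φ**) ⇒ φ*. For c := ψ* both (c ⊗ c*) ⇒ c* and
-- (c ⊗ c*) ⇒ c hold; by A4 the first yields X := (c ⊗ c*) ∘ c*, while the second
-- is literally X*. This contradiction explodes: the rule of addition turns X into
-- (X* ⊗ Z*)*, and A6 applied to the commutativity A5 gives (X* ⊗ (Z* ⊗ X*)*) ⇒ Z**,
-- so every double negation is a theorem. Every negation b* then follows from
-- b** and b***, and every formula φ from the negation (ψ ⇒ ψ) ⇒ φ by A1.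

Rep-refl : ∀ {φ ψ} χ → Rep φ ψ χ χ
Rep-refl (var n) = var n
Rep-refl (a ⊗ b) = Rep-refl a ⊗ Rep-refl b
Rep-refl (a ∘ b) = Rep-refl a ∘ Rep-refl b
Rep-refl (a *)   = Rep-refl a *

⊗-comm-⇒ : ∀ φ ψ → ⊢Id1 ((φ ⊗ ψ) ⇒ (ψ ⊗ φ))
⊗-comm-⇒ φ ψ = Simp (A5 φ ψ)

contrapose : ∀ {φ ψ χ} → ⊢Id1 ((φ ⊗ ψ) ⇒ χ) → ⊢Id1 ((φ ⊗ (χ *)) ⇒ (ψ *))
contrapose {φ} {ψ} {χ} = MP (A6 φ ψ χ)

⊗-comm-antecedent : ∀ {φ ψ χ} → ⊢Id1 ((φ ⊗ ψ) ⇒ χ) → ⊢Id1 ((ψ ⊗ φ) ⇒ χ)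
⊗-comm-antecedent {φ} {ψ} {χ} h = Sub (A5 φ ψ) h ((∘ˡ here (Rep-refl (χ *))) *)

φ⊗¬φ⇒¬φ : ∀ φ → ⊢Id1 ((φ ⊗ (φ *)) ⇒ (φ *))
φ⊗¬φ⇒¬φ φ = contrapose (Id1 φ)

¬φ⊗¬¬φ⇒¬φ : ∀ φ → ⊢Id1 (((φ *) ⊗ ((φ *) *)) ⇒ (φ *))
¬φ⊗¬¬φ⇒¬φ φ = contrapose (⊗-comm-antecedent (φ⊗¬φ⇒¬φ φ))

explosion-¬¬ : ∀ {X} → ⊢Id1 X → ⊢Id1 (X *) → ∀ Z → ⊢Id1 ((Z *) *)
explosion-¬¬ {X} ⊢X ⊢X* Z =
  MP (contrapose (⊗-comm-⇒ (X *) (Z *))) (Adj ⊢X* ¬[¬Z⊗¬X])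
  where
    ¬[¬Z⊗¬X] : ⊢Id1 (((Z *) ⊗ (X *)) *)
    ¬[¬Z⊗¬X] = Sub (A5 (X *) (Z *)) (Add Z ⊢X) (here *)

¬φ⊗¬¬φ∘¬¬φ : ∀ φ → ⊢Id1 (((φ *) ⊗ ((φ *) *)) ∘ ((φ *) *))
¬φ⊗¬¬φ∘¬¬φ φ = MP (A4 _ _) (φ⊗¬φ⇒¬φ (φ *))

⊢¬¬ : ∀ φ → ⊢Id1 ((φ *) *)
⊢¬¬ = explosion-¬¬ (¬φ⊗¬¬φ∘¬¬φ (var 0)) (¬φ⊗¬¬φ⇒¬φ (var 0))

⊢¬ : ∀ φ → ⊢Id1 (φ *)
⊢¬ φ = MP ¬¬φ⊗¬¬¬φ⇒¬φ (Adj (⊢¬¬ φ) (⊢¬¬ (φ *)))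
  where
    ¬¬φ⊗¬¬¬φ⇒¬φ : ⊢Id1 ((((φ *) *) ⊗ (((φ *) *) *)) ⇒ (φ *))
    ¬¬φ⊗¬¬¬φ⇒¬φ = contrapose (⊗-comm-antecedent (contrapose (φ⊗¬φ⇒¬φ φ)))

proposition5p14 : ∀ (φ : Formula) → ⊢Id1 φ
proposition5p14 φ = MP (⊢¬ ((var 0 ⇒ var 0) ∘ (φ *))) (A1 (var 0))
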